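{- Let $n\ge2$ be an integer. If $n$ is odd, then the graph $\mathcal{G}_4(n)$ is a double graph covering of $\mathcal{G}_3(n)$. If $n$ is not a multiple of $3$, then the graph $\mathcal{G}_6(n)$ is a double graph covering of $\mathcal{G}_3(n)$.
   Context: $\mathcal{G}_3(n)$ (the underlying graph of the Farey map $\mathcal{M}_3(n)$) has vertices the pairs $(a,c)\in(\mathbb{Z}/n\mathbb{Z})^2$ with $\gcd(a,c,n)=1$ modulo $(a,c)\sim(-a,-c)$, written $[a/c]_n$, with $[a/c]_n$ and $[b/d]_n$ adjacent iff $ad-bc\equiv\pm1\pmod n$. For odd $n$, $\mathcal{G}_4(n)$ is the underlying graph of the Hecke map $\mathcal{M}_4(n)$ (the quotient of the universal Hecke map for the Hecke group generated by $\pm\begin{pmatrix}0&-1\\1&0\end{pmatrix}$ and $\pm\begin{pmatrix}1&\sqrt2\\0&1\end{pmatrix}$ by its congruence subgroup of level $n$); combinatorially it has two kinds of vertices: even vertices $[a/c\sqrt2]_n$ and odd vertices $[b\sqrt2/d]_n$, each indexed by pairs in $(\mathbb{Z}/n\mathbb{Z})^2$ with $\gcd(\cdot,\cdot,n)=1$ modulo $\pm1$; an even vertex $[a/c\sqrt2]_n$ and an odd vertex $[b\sqrt2/d]_n$ are adjacent iff $ad-2bc\equiv\pm1\pmod n$, and there are no other adjacencies. For $3\nmid n$, $\mathcal{G}_6(n)$ (underlying graph of the Hecke map $\mathcal{M}_6(n)$, with $\sqrt3$ in place of $\sqrt2$) is defined in the same way with even vertices $[a/c\sqrt3]_n$, odd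 vertices $[b\sqrt3/d]_n$, and adjacency iff $ad-3bc\equiv\pm1\pmod n$. A double graph covering of $\mathcal{G}_2$ by $\mathcal{G}_1$ is a map $\pi$ from the vertices of $\mathcal{G}_1$ to those of $\mathcal{G}_2$, preserving adjacency, such that for every vertex $v$ of $\mathcal{G}_2$ and each $w\in\pi^{ -1}(v)$, $\pi$ maps the neighbours of $w$ bijectively onto the neighbours of $v$, and every vertex of $\mathcal{G}_2$ has exactly two preimages. -}

module Defs where

open import Data.Integer using (ℤ; +_; _-_; _*_; -_; 1ℤ)
open import Data.Integer.Divisibility using (_∣_)
open import Data.Integer.GCD using (gcd)
open import Data.Nat using (ℕ)
open import Data.Product using (Σ; ∃; ∃₂; _×_; _,_)
open import Data.Sum using (_⊎_)
open import Data.Empty using (⊥)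
open import Relation.Binary.PropositionalEquality using (_≡_)
open import Relation.Nullary using (¬_)

ModEq : ℕ → ℤ → ℤ → Set
ModEq n x y = (+ n) ∣ (x - y)

PlusMinusOne : ℕ → ℤ → Set
PlusMinusOne n x = ModEq n x 1ℤ ⊎ ModEq n x (- 1ℤ)

-- A pair (a , c) of integers, read as an element of (ℤ/nℤ)², with gcd(a,c,n) = 1
record PrimPair (n : ℕ) : Set where
  constructor prim
  field
    fst  : ℤ
    snd  : ℤ
    prim-gcd : gcd (gcd fst snd) (+ n) ≡ 1ℤ
open PrimPair public

-- (a,c) ~ (b,d)  iff  (a,c) ≡ ±(b,d) in (ℤ/nℤ)²  (so vertices are classes mod ±1)
PairEq : (n : ℕ) → PrimPair n → PrimPair n → Set
PairEq n p q =
  (ModEq n (fst p) (fst q) × ModEq n (snd p) (snd q))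
  ⊎ (ModEq n (fst p) (- fst q) × ModEq n (snd p) (- snd q))

-- A graph presented by a type of vertex representatives, an equivalence
-- ("same vertex") on representatives, and an adjacency relation.
record Graph : Set₁ where
  field
    V    : Set
    _≈_  : V → V → Set
    Adj  : V → V → Set

G₃ : ℕ → Graph
G₃ n = record
  { V   = PrimPair n
  ; _≈_ = PairEq n
  ; Adj = λ p q → PlusMinusOne n (fst p * snd q - fst q * snd p)
  }

data Kind : Set where
  even odd : Kind

HVertex : ℕ → Set
HVertex n = Kind × PrimPair n

HEq : (n : ℕ) → HVertex n → HVertex n → Set
HEq n (even , p) (even , q) = PairEq n p q
HEq n (odd  , p) (odd  , q) = PairEq n p q
HEq n (even , p) (odd  , q) = ⊥
HEq n (odd  , p) (even , q) = ⊥

-- Hecke graph with parameter m (m = 2 gives G₄(n), m = 3 gives G₆(n)):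
-- even vertex (even , (a , c)) = [a / c√m]ₙ, odd vertex (odd , (b , d)) = [b√m / d]ₙ,
-- adjacent iff a d - m b c ≡ ±1 (mod n); no even–even or odd–odd edges.
HAdj : (m n : ℕ) → HVertex n → HVertex n → Set
HAdj m n (even , p) (odd  , q) = PlusMinusOne n (fst p * snd q - (+ m) * fst q * snd p)
HAdj m n (odd  , q) (even , p) = PlusMinusOne n (fst p * snd q - (+ m) * fst q * snd p)
HAdj m n (even , p) (even , q) = ⊥
HAdj m n (odd  , p) (odd  , q) = ⊥

HeckeGraph : ℕ → ℕ → Graph
HeckeGraph m n = record { V = HVertex n ; _≈_ = HEq n ; Adj = HAdj m n }

G₄ : ℕ → Graph
G₄ = HeckeGraph 2

G₆ : ℕ → Graph
G₆ = HeckeGraph 3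

record DoubleCovering (G₁ G₂ : Graph) : Set where
  private
    module A = Graph G₁
    module B = Graph G₂
  field
    π       : A.V → B.V
    π-cong  : ∀ {w w′} → w A.≈ w′ → π w B.≈ π w′
    π-adj   : ∀ {w w′} → A.Adj w w′ → B.Adj (π w) (π w′)
    nbr-surj : ∀ w v → B.Adj (π w) v → ∃ λ w′ → A.Adj w w′ × (π w′ B.≈ v)
    nbr-inj  : ∀ w w′ w″ → A.Adj w w′ → A.Adj w w″ → π w′ B.≈ π w″ → w′ A.≈ w″
    two-preimages : ∀ v → ∃₂ λ w₁ w₂ →
      (π w₁ B.≈ v) × (π w₂ B.≈ v) × ¬ (w₁ A.≈ w₂)
      × (∀ w → π w B.≈ v → (w A.≈ w₁) ⊎ (w A.≈ w₂))

-- Let m be invertible modulo n, with m t ≡ 1. Send an even vertex [a/c√m] of the Hecke graph to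
-- [a/c] and an odd vertex [b√m/d] to [mb/d]. The Hecke determinant a d - m b c of an even and an
-- odd vertex is exactly the Farey determinant of their images, so edges go to edges; and
-- multiplying the numerator by m permutes the vertices of G₃(n), with inverse multiplication by
-- t. Hence [x/y] has exactly the two preimages [x/y√m] and [tx√m/y], and since every Hecke edge
-- joins an even and an odd vertex, π maps the neighbours of a vertex bijectively onto those of
-- its image. For m = 2 and m = 3, invertibility modulo n just says 2 ∤ n and 3 ∤ n.
module Submission where

open import Defs
open import Data.Nat using (ℕ; _≤_)
open import Data.Nat.Divisibility using (_∣_)
open import Data.Product using (_×_)
open import Relation.Nullary using (¬_)

open import Data.Empty using (⊥-elim)
open import Data.Integer using (ℤ; +_; _+_; _-_; _*_; -_; 0ℤ; 1ℤ)
import Data.Integer.Divisibility as Unsigned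
import Data.Integer.Divisibility.Signed as Signed
open import Data.Integer.GCD using (gcd; gcd[i,j]∣i; gcd[i,j]∣j; gcd-greatest)
import Data.Integer.Properties as ℤ
open import Data.Integer.Tactic.RingSolver using (solve; solve-∀)
open import Data.List using ([]; _∷_)
import Data.Nat as ℕ
open import Data.Nat.Coprimality using (Coprime; coprime-Bézout)
import Data.Nat.Divisibility as ℕ
open import Data.Nat.GCD using (module Bézout)
open import Data.Nat.Primality using (Prime; prime?; prime[2]; prime⇒irreducible)
open import Data.Product using (∃; ∃₂; _,_; proj₂)
open import Data.Sum using (_⊎_; inj₁; inj₂)
open import Relation.Binary.PropositionalEquality
  using (_≡_; refl; sym; cong; subst; module ≡-Reasoning)
open import Relation.Nullary.Decidable using (from-yes)

private
  variable
    n : ℕ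
    k x y z x′ y′ : ℤ

-- A record rather than ModEq itself: ModEq n x y mentions x and y only through x - y, so Agda
-- cannot infer them from it.
infix 4 _≡_mod_

record _≡_mod_ (x y : ℤ) (n : ℕ) : Set where
  constructor ≡mod-intro
  field
    divides-difference : + n Signed.∣ x - y

open _≡_mod_

ModEq⇒≡mod : ∀ x y → ModEq n x y → x ≡ y mod n
ModEq⇒≡mod {n} x y d = ≡mod-intro (Signed.∣ᵤ⇒∣ {+ n} {x - y} d)

≡mod⇒ModEq : x ≡ y mod n → ModEq n x y
≡mod⇒ModEq {x} {y} {n} x≡y = Signed.∣⇒∣ᵤ {+ n} {x - y} (divides-difference x≡y)

multiple⇒≡mod : x - y ≡ k * + n → x ≡ y mod n
multiple⇒≡mod {k = k} eq = ≡mod-intro (Signed.divides k eq)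

≡mod-linear : ∀ k → x′ - y′ ≡ k * (x - y) → x ≡ y mod n → x′ ≡ y′ mod n
≡mod-linear k eq (≡mod-intro d) =
  ≡mod-intro (subst (_ Signed.∣_) (sym eq) (Signed.∣n⇒∣m*n k d))

≡mod-refl : x ≡ x mod n
≡mod-refl {x = x} = multiple⇒≡mod {k = 0ℤ} (solve (x ∷ []))

≡⇒≡mod : x ≡ y → x ≡ y mod n
≡⇒≡mod refl = ≡mod-refl

≡mod-sym : x ≡ y mod n → y ≡ x mod n
≡mod-sym {x = x} {y = y} = ≡mod-linear (- 1ℤ) (solve (x ∷ y ∷ []))

≡mod-trans : x ≡ y mod n → y ≡ z mod n → x ≡ z mod n
≡mod-trans {x = x} {y = y} {z = z} (≡mod-intro d) (≡mod-intro e) =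
  ≡mod-intro (subst (_ Signed.∣_) telescope (Signed.∣m∣n⇒∣m+n d e))
  where
  telescope : (x - y) + (y - z) ≡ x - z
  telescope = solve (x ∷ y ∷ z ∷ [])

≡mod-neg : x ≡ y mod n → - x ≡ - y mod n
≡mod-neg {x = x} {y = y} = ≡mod-linear (- 1ℤ) (solve (x ∷ y ∷ []))

≡mod-flip : x ≡ - y mod n → y ≡ - x mod n
≡mod-flip {x = x} {y = y} = ≡mod-linear 1ℤ (solve (x ∷ y ∷ []))

≡mod-*ˡ : ∀ s → x ≡ y mod n → s * x ≡ s * y mod n
≡mod-*ˡ {x = x} {y = y} s = ≡mod-linear s (solve (s ∷ x ∷ y ∷ []))

≡mod-*ˡ-neg : ∀ s → x ≡ - y mod n → s * x ≡ - (s * y) mod n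
≡mod-*ˡ-neg {x = x} {y = y} s = ≡mod-linear s (solve (s ∷ x ∷ y ∷ []))

*-cancelˡ-≡mod : ∀ t s a → t * s ≡ 1ℤ mod n → t * (s * a) ≡ a mod n
*-cancelˡ-≡mod t s a = ≡mod-linear a (solve (t ∷ s ∷ a ∷ []))

PlusMinusOne-resp : x ≡ y mod n → PlusMinusOne n x → PlusMinusOne n y
PlusMinusOne-resp {x = x} x≡y (inj₁ x≡1) =
  inj₁ (≡mod⇒ModEq (≡mod-trans (≡mod-sym x≡y) (ModEq⇒≡mod x 1ℤ x≡1)))
PlusMinusOne-resp {x = x} x≡y (inj₂ x≡-1) =
  inj₂ (≡mod⇒ModEq (≡mod-trans (≡mod-sym x≡y) (ModEq⇒≡mod x (- 1ℤ) x≡-1)))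

PlusMinusOne-neg : ∀ x → PlusMinusOne n x → PlusMinusOne n (- x)
PlusMinusOne-neg x (inj₁ x≡1) =
  inj₂ (≡mod⇒ModEq (≡mod-neg (ModEq⇒≡mod x 1ℤ x≡1)))
PlusMinusOne-neg x (inj₂ x≡-1) =
  inj₁ (≡mod⇒ModEq (≡mod-neg (ModEq⇒≡mod x (- 1ℤ) x≡-1)))

PlusMinusOne-swap : ∀ x y → PlusMinusOne n (x - y) → PlusMinusOne n (y - x)
PlusMinusOne-swap x y d =
  PlusMinusOne-resp (≡⇒≡mod -[x-y]≡y-x) (PlusMinusOne-neg (x - y) d)
  where
  -[x-y]≡y-x : - (x - y) ≡ y - x
  -[x-y]≡y-x = solve (x ∷ y ∷ [])

pos-+-* : ∀ d a b c e → d ℕ.+ a ℕ.* b ≡ c ℕ.* e → + d + + a * + b ≡ + c * + e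
pos-+-* d a b c e eq = begin
  + d + + a * + b    ≡⟨ cong (λ z → + d + z) (ℤ.pos-* a b) ⟨
  + d + + (a ℕ.* b)  ≡⟨ ℤ.pos-+ d (a ℕ.* b) ⟨
  + (d ℕ.+ a ℕ.* b)  ≡⟨ cong +_ eq ⟩
  + (c ℕ.* e)        ≡⟨ ℤ.pos-* c e ⟩
  + c * + e          ∎
  where open ≡-Reasoning

coprime⇒invertible : ∀ {m n} → Coprime m n → ∃ λ t → + m * t ≡ 1ℤ mod n
coprime⇒invertible {m} {n} m⊥n with coprime-Bézout m⊥n
... | Bézout.+- x y eq = + x , multiple⇒≡mod {k = + y} (begin
  + m * + x - 1ℤ       ≡⟨ cong (_- 1ℤ) (ℤ.*-comm (+ m) (+ x)) ⟩
  + x * + m - 1ℤ       ≡⟨ cong (_- 1ℤ) (pos-+-* 1 y n x m eq) ⟨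
  1ℤ + + y * + n - 1ℤ  ≡⟨ 1+z-1≡z (+ y * + n) ⟩
  + y * + n            ∎)
  where
  open ≡-Reasoning
  1+z-1≡z : ∀ z → 1ℤ + z - 1ℤ ≡ z
  1+z-1≡z = solve-∀
... | Bézout.-+ x y eq = - + x , multiple⇒≡mod {k = - + y} (begin
  + m * - + x - 1ℤ     ≡⟨ m[-x]-1≡-[1+xm] (+ m) (+ x) ⟩
  - (1ℤ + + x * + m)   ≡⟨ cong -_ (pos-+-* 1 x m y n eq) ⟩
  - (+ y * + n)        ≡⟨ ℤ.neg-distribˡ-* (+ y) (+ n) ⟩
  - + y * + n          ∎)
  where
  open ≡-Reasoning
  m[-x]-1≡-[1+xm] : ∀ m x → m * - x - 1ℤ ≡ - (1ℤ + x * m)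
  m[-x]-1≡-[1+xm] = solve-∀

prime∤⇒coprime : ∀ {p n} → Prime p → ¬ (p ∣ n) → Coprime p n
prime∤⇒coprime pr p∤n (d∣p , d∣n) with prime⇒irreducible pr d∣p
... | inj₁ d≡1  = d≡1
... | inj₂ refl = ⊥-elim (p∤n d∣n)

gcd-*ˡ-∣-gcd : ∀ s t a c → s * t ≡ 1ℤ mod n →
               gcd (gcd (s * a) c) (+ n) Unsigned.∣ gcd (gcd a c) (+ n)
gcd-*ˡ-∣-gcd {n = n} s t a c (≡mod-intro n∣st-1) =
  gcd-greatest {gcd a c} {+ n} {g} (gcd-greatest {a} {c} {g} g∣a g∣c) g∣n
  where
  g : ℤ
  g = gcd (gcd (s * a) c) (+ n)
  g∣sa,c : g Unsigned.∣ gcd (s * a) c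
  g∣sa,c = gcd[i,j]∣i (gcd (s * a) c) (+ n)
  g∣n : g Unsigned.∣ + n
  g∣n = gcd[i,j]∣j (gcd (s * a) c) (+ n)
  g∣c : g Unsigned.∣ c
  g∣c = ℕ.∣-trans g∣sa,c (gcd[i,j]∣j (s * a) c)
  g∣sa : g Signed.∣ s * a
  g∣sa = Signed.∣ᵤ⇒∣ {g} {s * a} (ℕ.∣-trans g∣sa,c (gcd[i,j]∣i (s * a) c))
  g∣st-1 : g Signed.∣ s * t - 1ℤ
  g∣st-1 = Signed.∣-trans (Signed.∣ᵤ⇒∣ {g} {+ n} g∣n) n∣st-1
  t[sa]-a[st-1]≡a : t * (s * a) - a * (s * t - 1ℤ) ≡ a
  t[sa]-a[st-1]≡a = solve (s ∷ t ∷ a ∷ [])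
  g∣a : g Unsigned.∣ a
  g∣a = Signed.∣⇒∣ᵤ {g} {a} (subst (g Signed.∣_) t[sa]-a[st-1]≡a
          (Signed.∣m∣n⇒∣m-n (Signed.∣n⇒∣m*n t g∣sa)
                             (Signed.∣n⇒∣m*n a g∣st-1)))

-- Opaque because otherwise Agda normalises this proof (a computation on gcds) whenever it
-- compares two scaled pairs, which makes typechecking the covering impractically slow.
opaque
  gcd≡1-*ˡ : ∀ s t a c → s * t ≡ 1ℤ mod n →
             gcd (gcd a c) (+ n) ≡ 1ℤ → gcd (gcd (s * a) c) (+ n) ≡ 1ℤ
  gcd≡1-*ˡ {n = n} s t a c st≡1 gcd≡1 = cong +_ (ℕ.∣1⇒≡1 g∣1)
    where
    g∣1 : gcd (gcd (s * a) c) (+ n) Unsigned.∣ 1ℤ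
    g∣1 = subst (gcd (gcd (s * a) c) (+ n) Unsigned.∣_) gcd≡1 (gcd-*ˡ-∣-gcd s t a c st≡1)

infix 4 _≈_

data _≈_ {n : ℕ} (p q : PrimPair n) : Set where
  same     : fst p ≡ fst q mod n → snd p ≡ snd q mod n → p ≈ q
  opposite : fst p ≡ - fst q mod n → snd p ≡ - snd q mod n → p ≈ q

≈⇒PairEq : {p q : PrimPair n} → p ≈ q → PairEq n p q
≈⇒PairEq (same a c)     = inj₁ (≡mod⇒ModEq a , ≡mod⇒ModEq c)
≈⇒PairEq (opposite a c) = inj₂ (≡mod⇒ModEq a , ≡mod⇒ModEq c)

PairEq⇒≈ : (p q : PrimPair n) → PairEq n p q → p ≈ q
PairEq⇒≈ p q (inj₁ (a , c)) =
  same (ModEq⇒≡mod (fst p) (fst q) a) (ModEq⇒≡mod (snd p) (snd q) c)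
PairEq⇒≈ p q (inj₂ (a , c)) =
  opposite (ModEq⇒≡mod (fst p) (- fst q) a) (ModEq⇒≡mod (snd p) (- snd q) c)

≈-refl : {p : PrimPair n} → p ≈ p
≈-refl = same ≡mod-refl ≡mod-refl

≈-sym : {p q : PrimPair n} → p ≈ q → q ≈ p
≈-sym (same a c)     = same (≡mod-sym a) (≡mod-sym c)
≈-sym (opposite a c) = opposite (≡mod-flip a) (≡mod-flip c)

≈-trans : {p q r : PrimPair n} → p ≈ q → q ≈ r → p ≈ r
≈-trans (same a c) (same a′ c′) = same (≡mod-trans a a′) (≡mod-trans c c′)
≈-trans (same a c) (opposite a′ c′) = opposite (≡mod-trans a a′) (≡mod-trans c c′)
≈-trans (opposite a c) (same a′ c′) =
  opposite (≡mod-trans a (≡mod-neg a′)) (≡mod-trans c (≡mod-neg c′))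
≈-trans (opposite a c) (opposite a′ c′) =
  same (≡mod-trans a (≡mod-sym (≡mod-flip a′)))
       (≡mod-trans c (≡mod-sym (≡mod-flip c′)))

scaleNumerator : ∀ s t → s * t ≡ 1ℤ mod n → PrimPair n → PrimPair n
scaleNumerator s t st≡1 p =
  prim (s * fst p) (snd p) (gcd≡1-*ˡ s t (fst p) (snd p) st≡1 (prim-gcd p))

scaleNumerator-cong : ∀ s t (st≡1 : s * t ≡ 1ℤ mod n) {p q} →
                      p ≈ q → scaleNumerator s t st≡1 p ≈ scaleNumerator s t st≡1 q
scaleNumerator-cong s t st≡1 (same a c)     = same (≡mod-*ˡ s a) c
scaleNumerator-cong s t st≡1 (opposite a c) = opposite (≡mod-*ˡ-neg s a) c

scaleNumerator-cancel : ∀ s t (st≡1 : s * t ≡ 1ℤ mod n) (ts≡1 : t * s ≡ 1ℤ mod n) →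
                        ∀ p →
                        scaleNumerator t s ts≡1 (scaleNumerator s t st≡1 p) ≈ p
scaleNumerator-cancel s t st≡1 ts≡1 p = same (*-cancelˡ-≡mod t s (fst p) ts≡1) ≡mod-refl

module HeckeCovering {m n : ℕ} (t : ℤ) (mt≡1 : + m * t ≡ 1ℤ mod n) where

  tm≡1 : t * + m ≡ 1ℤ mod n
  tm≡1 = subst (_≡ 1ℤ mod n) (ℤ.*-comm (+ m) t) mt≡1

  π-odd : PrimPair n → PrimPair n
  π-odd = scaleNumerator (+ m) t mt≡1

  lift : PrimPair n → PrimPair n
  lift = scaleNumerator t (+ m) tm≡1

  lift-π-odd : ∀ q → lift (π-odd q) ≈ q
  lift-π-odd = scaleNumerator-cancel (+ m) t mt≡1 tm≡1

  π-odd-lift : ∀ v → π-odd (lift v) ≈ v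
  π-odd-lift = scaleNumerator-cancel t (+ m) tm≡1 mt≡1

  π-odd≈⇒≈lift : ∀ q {v} → π-odd q ≈ v → q ≈ lift v
  π-odd≈⇒≈lift q mq≈v =
    ≈-trans (≈-sym (lift-π-odd q)) (scaleNumerator-cong t (+ m) tm≡1 mq≈v)

  π-odd-injective : ∀ q q′ → π-odd q ≈ π-odd q′ → q ≈ q′
  π-odd-injective q q′ mq≈mq′ =
    ≈-trans (π-odd≈⇒≈lift q mq≈mq′) (lift-π-odd q′)

  π : HVertex n → PrimPair n
  π (even , p) = p
  π (odd , q)  = π-odd q

  π-cong : ∀ {w w′} → HEq n w w′ → PairEq n (π w) (π w′)
  π-cong {even , _} {even , _} e = e
  π-cong {odd , q} {odd , q′} e =
    ≈⇒PairEq (scaleNumerator-cong (+ m) t mt≡1 (PairEq⇒≈ q q′ e))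

  π-adj : ∀ {w w′} → HAdj m n w w′ →
          PlusMinusOne n (fst (π w) * snd (π w′) - fst (π w′) * snd (π w))
  π-adj {even , _} {odd , _} adj = adj
  π-adj {odd , q} {even , p} adj =
    PlusMinusOne-swap (fst p * snd q) (+ m * fst q * snd p) adj

  nbr-surj : ∀ w v → PlusMinusOne n (fst (π w) * snd v - fst v * snd (π w)) →
             ∃ λ w′ → HAdj m n w w′ × PairEq n (π w′) v
  nbr-surj (even , prim a c _) v@(prim x y _) adj =
    (odd , lift v) , PlusMinusOne-resp det≡ adj , ≈⇒PairEq (π-odd-lift v)
    where
    difference : ∀ m t a c x y →
                 (a * y - x * c) - (a * y - m * (t * x) * c) ≡ c * (m * (t * x) - x)
    difference = solve-∀
    det≡ : a * y - x * c ≡ a * y - + m * (t * x) * c mod n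
    det≡ = ≡mod-linear c (difference (+ m) t a c x y) (*-cancelˡ-≡mod (+ m) t x mt≡1)
  nbr-surj (odd , q) v adj =
    (even , v) ,
    PlusMinusOne-swap (+ m * fst q * snd v) (fst v * snd q) adj ,
    ≈⇒PairEq (≈-refl {p = v})

  nbr-inj : ∀ w w′ w″ → HAdj m n w w′ → HAdj m n w w″ →
            PairEq n (π w′) (π w″) → HEq n w′ w″
  nbr-inj (even , _) (odd , q) (odd , q′) _ _ e =
    ≈⇒PairEq (π-odd-injective q q′ (PairEq⇒≈ (π-odd q) (π-odd q′) e))
  nbr-inj (odd , _) (even , _) (even , _) _ _ e = e

  two-preimages : ∀ v → ∃₂ λ w₁ w₂ →
    PairEq n (π w₁) v × PairEq n (π w₂) v × ¬ (HEq n w₁ w₂)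
    × (∀ w → PairEq n (π w) v → HEq n w w₁ ⊎ HEq n w w₂)
  two-preimages v =
    (even , v) , (odd , lift v) ,
    ≈⇒PairEq (≈-refl {p = v}) , ≈⇒PairEq (π-odd-lift v) , (λ ()) , fibre
    where
    fibre : ∀ w → PairEq n (π w) v → HEq n w (even , v) ⊎ HEq n w (odd , lift v)
    fibre (even , _) e = inj₁ e
    fibre (odd , q) e  = inj₂ (≈⇒PairEq (π-odd≈⇒≈lift q (PairEq⇒≈ (π-odd q) v e)))

  covering : DoubleCovering (HeckeGraph m n) (G₃ n)
  covering = record
    { π             = π
    ; π-cong        = π-cong
    ; π-adj         = π-adj
    ; nbr-surj      = nbr-surj
    ; nbr-inj       = nbr-inj
    ; two-preimages = two-preimages
    }

heckeDoubleCovering : ∀ {m n} → Coprime m n → DoubleCovering (HeckeGraph m n) (G₃ n)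
heckeDoubleCovering m⊥n = HeckeCovering.covering _ (proj₂ (coprime⇒invertible m⊥n))

theorem9p1 : (n : ℕ) → 2 ≤ n →
    (¬ (2 ∣ n) → DoubleCovering (G₄ n) (G₃ n))
    × (¬ (3 ∣ n) → DoubleCovering (G₆ n) (G₃ n))
theorem9p1 n _ =
  (λ 2∤n → heckeDoubleCovering (prime∤⇒coprime prime[2] 2∤n)) ,
  (λ 3∤n → heckeDoubleCovering (prime∤⇒coprime (from-yes (prime? 3)) 3∤n))
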